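{- Let $G$ be a graph with edge set $E$ and connectivity function $\gamma$, and let $\lambda$ be a connectivity function on $E$. Suppose that for every edge $e$ of $G$ and every $e$-controlled set $Y\subseteq E$ we have $\lambda(Y)=\gamma(Y)$. Then for any $X\subseteq E$ and any $e\in E-X$, $$\lambda(X\cup\{e\})-\lambda(X)\le\gamma(X\cup\{e\})-\gamma(X).$$
   Context: A connectivity function on a finite set $E$ is a function $\lambda:2^E\to\mathbb R$ with $\lambda(\emptyset)=0$, $\lambda(X)=\lambda(E-X)$ for all $X\subseteq E$, and $\lambda(X\cap Y)+\lambda(X\cup Y)\le\lambda(X)+\lambda(Y)$ for all $X,Y\subseteq E$. For a graph $G$ without isolated vertices and $X\subseteq E(G)$, $V(X)$ is the set of vertices incident with an edge of $X$ and $\gamma(X)=|V(X)|+|V(E-X)|-|V(E)|$. For a vertex $v$, $S_v$ is the set of edges incident with $v$. For a set $S$, a subset $S'\subseteq S$ is controlled if $S'=S$, or $S'=\emptyset$, or $|S'|=1$. For an edge $e$ with endvertices $u,v$, a set $Y\subseteq E$ is $e$-controlled if it is the union of three controlled subsets, one of each of $S_u-\{e\}$, $S_v-\{e\}$ and $\{e\}$. -}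

module Defs where

open import Level using (Level; suc)
open import Data.Nat as ℕ using (ℕ; zero; _∸_) renaming (suc to sucℕ; _+_ to _+ℕ_)
open import Data.Fin using (Fin; _≟_)
open import Data.Fin.Subset using (Subset; ⊥; ⊤; ∁; _∩_; _∪_; _⊆_; ∣_∣; _-_; ⁅_⁆; _∈_)
open import Data.Vec using (tabulate)
open import Data.Bool using (Bool; _∨_; _∧_; true)
open import Data.Product using (_×_; Σ; ∃)
open import Data.Sum using (_⊎_)
open import Data.Empty renaming (⊥ to Empty)
import Data.Fin as Fin
open import Relation.Nullary.Decidable using (⌊_⌋)
open import Relation.Binary.PropositionalEquality using (_≡_)

-- Codomain of connectivity functions.  The paper uses ℝ; we work over an
-- arbitrary totally ordered abelian group (with ordinary equality) equipped
-- with a distinguished positive element `one` (so that integer-valued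
-- functions such as γ can be compared with λ).  ℝ with 1 is an instance.

record OrderedAbelianGroup (a : Level) : Set (suc a) where
  infixl 6 _+_ _−_
  infix 4 _≤_
  field
    Carrier : Set a
    _+_     : Carrier → Carrier → Carrier
    0#      : Carrier
    -_      : Carrier → Carrier
    _≤_     : Carrier → Carrier → Set a
    one     : Carrier
    +-assoc    : ∀ x y z → (x + y) + z ≡ x + (y + z)
    +-comm     : ∀ x y → x + y ≡ y + x
    +-identityˡ : ∀ x → 0# + x ≡ x
    -‿inverseˡ : ∀ x → (- x) + x ≡ 0#
    ≤-refl     : ∀ {x} → x ≤ x
    ≤-trans    : ∀ {x y z} → x ≤ y → y ≤ z → x ≤ z
    ≤-antisym  : ∀ {x y} → x ≤ y → y ≤ x → x ≡ y
    ≤-total    : ∀ x y → x ≤ y ⊎ y ≤ x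
    +-monoˡ-≤  : ∀ {x y} z → x ≤ y → x + z ≤ y + z
    0<one      : (0# ≤ one) × (one ≡ 0# → Empty)

  _−_ : Carrier → Carrier → Carrier
  x − y = x + (- y)

  ι : ℕ → Carrier
  ι zero     = 0#
  ι (sucℕ n) = one + ι n

module _ {a} (R : OrderedAbelianGroup a) where
  open OrderedAbelianGroup R

  record IsConnectivityFunction {m : ℕ} (λf : Subset m → Carrier) : Set a where
    field
      empty     : λf ⊥ ≡ 0#
      symmetric : ∀ X → λf X ≡ λf (∁ X)
      submod    : ∀ X Y → λf (X ∩ Y) + λf (X ∪ Y) ≤ λf X + λf Y

-- Finite graphs (loops and parallel edges allowed): vertex set Fin n,
-- edge set Fin m, each edge with an (unordered) pair of endvertices.

record Graph (n m : ℕ) : Set where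
  field
    ends : Fin m → Fin n × Fin n

module _ {n m : ℕ} (G : Graph n m) where
  open Graph G
  open Data.Product using (proj₁; proj₂)

  incident : Fin n → Fin m → Bool
  incident v e = ⌊ v ≟ proj₁ (ends e) ⌋ ∨ ⌊ v ≟ proj₂ (ends e) ⌋

  NoIsolatedVertices : Set
  NoIsolatedVertices = ∀ (v : Fin n) → ∃ λ (e : Fin m) → incident v e ≡ true

  private
    anyFin : ∀ {k} → (Fin k → Bool) → Bool
    anyFin {zero}   f = Data.Bool.false
    anyFin {sucℕ k} f = f Fin.zero ∨ anyFin (λ i → f (Fin.suc i))

  V : Subset m → Subset n
  V X = tabulate λ v → anyFin λ e → Data.Vec.lookup X e ∧ incident v e

  -- γ(X) = |V(X)| + |V(E − X)| − |V(E)|   (always ≥ 0, so ∸ is exact)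
  γ : Subset m → ℕ
  γ X = (∣ V X ∣ +ℕ ∣ V (∁ X) ∣) ∸ ∣ V ⊤ ∣

  S : Fin n → Subset m
  S v = tabulate λ e → incident v e

  Controlled : Subset m → Subset m → Set
  Controlled T T' = T' ⊆ T × (T' ≡ T ⊎ T' ≡ ⊥ ⊎ ∣ T' ∣ ≡ 1)

  eControlled : Fin m → Subset m → Set
  eControlled e Y =
    Σ (Subset m) λ A → Σ (Subset m) λ B → Σ (Subset m) λ C →
      Controlled (S (proj₁ (ends e)) - e) A ×
      Controlled (S (proj₂ (ends e)) - e) B ×
      Controlled ⁅ e ⁆ C ×
      Y ≡ (A ∪ B) ∪ C

-- Let u, v be the ends of e.  For w ∈ {u, v} choose a controlled subset A_w of
-- (S_w − e) ∩ X that meets S_w − e whenever X does and is all of S_w − e only when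
-- X contains it, and put Y = A_u ∪ A_v ⊆ X.  Submodularity for X and Y ∪ e gives
-- λ(X ∪ e) − λ(X) ≤ λ(Y ∪ e) − λ(Y), which is γ(Y ∪ e) − γ(Y) since Y and Y ∪ e
-- are e-controlled.  For Z ∌ e,
--   γ(Z ∪ e) − γ(Z) = |V(E − (Z ∪ e)) ∩ {u,v}| − |V(Z) ∩ {u,v}|,
-- and whether w ∈ V(Z) or w ∈ V(E − (Z ∪ e)) only depends on whether Z meets, resp.
-- contains, S_w − e; by the choice of A_u, A_v this is the same for Z = Y and Z = X.

module Submission where

open import Defs
open import Data.Bool using (true; false; _∧_; _∨_)
open import Data.Bool.Properties using (∨-zeroʳ)
open import Data.Fin using (Fin; zero; suc; _≟_)
open import Data.Fin.Subset
  using (Subset; ⊥; ⊤; ∁; _∪_; _∩_; _─_; _-_; ⁅_⁆; _∈_; _∉_; _⊆_; ∣_∣; Nonempty)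
open import Data.Fin.Subset.Properties
  using ( ⊆-refl; ⊆-antisym; ⊥⊆; x∈⁅x⁆; x∈⁅y⁆⇒x≡y; ∣⁅x⁆∣≡1; nonempty?; p∪∁p≡⊤
        ; x∈p∪q⁺; x∈p∪q⁻; x∈p∩q⁺; x∈p∩q⁻; x∈∁p⇒x∉p; x∉p⇒x∈∁p; x∉∁p⇒x∈p
        ; p─q⊆p; x∈p∧x≢y⇒x∈p-y; p⊆p∪q; q⊆p∪q; p⊆q⇒∁p⊇∁q; ∪-identityʳ)
open import Data.Nat as ℕ using (ℕ)
open import Data.Product as Product using (∃; _×_; _,_; proj₁; proj₂; map₁; map₂)
open import Data.Sum as Sum using (_⊎_; inj₁; inj₂)
open import Data.Vec using ([]; _∷_; lookup; here; there)
open import Data.Vec.Properties using (lookup∘tabulate; lookup⇒[]=; []=⇒lookup)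
open import Function using (_∘_)
open import Relation.Nullary using (yes; no; contradiction)
open import Relation.Binary.PropositionalEquality
  using (_≡_; _≢_; refl; sym; trans; cong; cong₂; subst; subst₂; module ≡-Reasoning)

module _ where
  open import Data.Nat using (_+_; _≤_; suc)
  open import Data.Nat.Properties using (+-suc; m≤m+n; ≤-reflexive; ≤-trans)

  ∣p∪q∣+∣p∩q∣≡∣p∣+∣q∣ : ∀ {k} (p q : Subset k) → ∣ p ∪ q ∣ + ∣ p ∩ q ∣ ≡ ∣ p ∣ + ∣ q ∣
  ∣p∪q∣+∣p∩q∣≡∣p∣+∣q∣ []          []          = refl
  ∣p∪q∣+∣p∩q∣≡∣p∣+∣q∣ (true  ∷ p) (true  ∷ q) =
    cong suc (trans (+-suc _ _) (trans (cong suc (∣p∪q∣+∣p∩q∣≡∣p∣+∣q∣ p q)) (sym (+-suc _ _))))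
  ∣p∪q∣+∣p∩q∣≡∣p∣+∣q∣ (true  ∷ p) (false ∷ q) = cong suc (∣p∪q∣+∣p∩q∣≡∣p∣+∣q∣ p q)
  ∣p∪q∣+∣p∩q∣≡∣p∣+∣q∣ (false ∷ p) (true  ∷ q) =
    trans (cong suc (∣p∪q∣+∣p∩q∣≡∣p∣+∣q∣ p q)) (sym (+-suc _ _))
  ∣p∪q∣+∣p∩q∣≡∣p∣+∣q∣ (false ∷ p) (false ∷ q) = ∣p∪q∣+∣p∩q∣≡∣p∣+∣q∣ p q

  ∣p∪q∣≤∣p∣+∣q∣ : ∀ {k} (p q : Subset k) → ∣ p ∪ q ∣ ≤ ∣ p ∣ + ∣ q ∣
  ∣p∪q∣≤∣p∣+∣q∣ p q = ≤-trans (m≤m+n _ _) (≤-reflexive (∣p∪q∣+∣p∩q∣≡∣p∣+∣q∣ p q))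

module _ {k : ℕ} {p : Subset k} {x : Fin k} where

  ∁p≡∁[p∪⁅x⁆]∪⁅x⁆ : x ∉ p → ∁ p ≡ ∁ (p ∪ ⁅ x ⁆) ∪ ⁅ x ⁆
  ∁p≡∁[p∪⁅x⁆]∪⁅x⁆ x∉p = ⊆-antisym to from
    where
    to : ∁ p ⊆ ∁ (p ∪ ⁅ x ⁆) ∪ ⁅ x ⁆
    to {y} y∈∁p with y ≟ x
    ... | yes refl = x∈p∪q⁺ (inj₂ (x∈⁅x⁆ x))
    ... | no y≢x = x∈p∪q⁺ (inj₁ (x∉p⇒x∈∁p λ y∈p∪x → case (x∈p∪q⁻ p ⁅ x ⁆ y∈p∪x)))
      where
      case : _ ⊎ _ → _
      case (inj₁ y∈p) = x∈∁p⇒x∉p y∈∁p y∈p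
      case (inj₂ y∈x) = y≢x (x∈⁅y⁆⇒x≡y x y∈x)
    from : ∁ (p ∪ ⁅ x ⁆) ∪ ⁅ x ⁆ ⊆ ∁ p
    from y∈ with x∈p∪q⁻ (∁ (p ∪ ⁅ x ⁆)) ⁅ x ⁆ y∈
    ... | inj₁ y∉p∪x = x∉p⇒x∈∁p λ y∈p → x∈∁p⇒x∉p y∉p∪x (x∈p∪q⁺ (inj₁ y∈p))
    ... | inj₂ y∈x rewrite x∈⁅y⁆⇒x≡y x y∈x = x∉p⇒x∈∁p x∉p

module _ {k : ℕ} {p q : Subset k} {x : Fin k} where

  p∩[q∪⁅x⁆]≡q : q ⊆ p → x ∉ p → p ∩ (q ∪ ⁅ x ⁆) ≡ q
  p∩[q∪⁅x⁆]≡q q⊆p x∉p = ⊆-antisym to (λ y∈q → x∈p∩q⁺ (q⊆p y∈q , x∈p∪q⁺ (inj₁ y∈q)))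
    where
    to : p ∩ (q ∪ ⁅ x ⁆) ⊆ q
    to y∈ with x∈p∩q⁻ p _ y∈
    ... | y∈p , y∈q∪x with x∈p∪q⁻ q ⁅ x ⁆ y∈q∪x
    ...   | inj₁ y∈q = y∈q
    ...   | inj₂ y∈x rewrite x∈⁅y⁆⇒x≡y x y∈x = contradiction y∈p x∉p

  p∪[q∪⁅x⁆]≡p∪⁅x⁆ : q ⊆ p → p ∪ (q ∪ ⁅ x ⁆) ≡ p ∪ ⁅ x ⁆
  p∪[q∪⁅x⁆]≡p∪⁅x⁆ q⊆p = ⊆-antisym to from
    where
    to : p ∪ (q ∪ ⁅ x ⁆) ⊆ p ∪ ⁅ x ⁆
    to y∈ with x∈p∪q⁻ p _ y∈
    ... | inj₁ y∈p = x∈p∪q⁺ (inj₁ y∈p)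
    ... | inj₂ y∈q∪x with x∈p∪q⁻ q ⁅ x ⁆ y∈q∪x
    ...   | inj₁ y∈q = x∈p∪q⁺ (inj₁ (q⊆p y∈q))
    ...   | inj₂ y∈x = x∈p∪q⁺ (inj₂ y∈x)
    from : p ∪ ⁅ x ⁆ ⊆ p ∪ (q ∪ ⁅ x ⁆)
    from y∈ with x∈p∪q⁻ p _ y∈
    ... | inj₁ y∈p = x∈p∪q⁺ (inj₁ y∈p)
    ... | inj₂ y∈x = x∈p∪q⁺ (inj₂ (x∈p∪q⁺ (inj₂ y∈x)))

private
  dropEdge : ∀ {n m} → Graph n (ℕ.suc m) → Graph n m
  dropEdge G = record { ends = Graph.ends G ∘ suc }

  lookup-V-∷ : ∀ {n m} (G : Graph n (ℕ.suc m)) z (Z : Subset m) (w : Fin n) →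
    lookup (V G (z ∷ Z)) w ≡ (z ∧ incident G w zero) ∨ lookup (V (dropEdge G) Z) w
  lookup-V-∷ G z Z w = trans (lookup∘tabulate _ w) (cong (z ∧ incident G w zero ∨_) tail)
    where
    tail : _ ≡ lookup (V (dropEdge G) Z) w
    tail = sym (lookup∘tabulate _ w)

∈V⁺ : ∀ {n m} (G : Graph n m) {Z : Subset m} {f : Fin m} {w : Fin n} →
  f ∈ Z → incident G w f ≡ true → w ∈ V G Z
∈V⁺ G {Z = true ∷ Z} {w = w} here inc = lookup⇒[]= w (V G (true ∷ Z))
  (trans (lookup-V-∷ G true Z w) (cong (_∨ lookup (V (dropEdge G) Z) w) inc))
∈V⁺ G {Z = z ∷ Z} {w = w} (there f∈Z) inc = lookup⇒[]= w (V G (z ∷ Z))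
  (trans (lookup-V-∷ G z Z w)
    (trans (cong (_ ∨_) ([]=⇒lookup (∈V⁺ (dropEdge G) f∈Z inc))) (∨-zeroʳ _)))

∈V⁻ : ∀ {n m} (G : Graph n m) {Z : Subset m} {w : Fin n} →
  w ∈ V G Z → ∃ λ f → f ∈ Z × incident G w f ≡ true
∈V⁻ G {[]} {w} w∈ = contradiction (trans (sym (lookup∘tabulate _ w)) ([]=⇒lookup w∈)) λ ()
∈V⁻ G {true ∷ Z} {w} w∈ with incident G w zero in inc | lookup-V-∷ G true Z w
... | true  | _  = zero , here , inc
... | false | eq = Product.map suc (map₁ there)
  (∈V⁻ (dropEdge G) (lookup⇒[]= w (V (dropEdge G) Z) (trans (sym eq) ([]=⇒lookup w∈))))
∈V⁻ G {false ∷ Z} {w} w∈ = Product.map suc (map₁ there)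
  (∈V⁻ (dropEdge G) (lookup⇒[]= w (V (dropEdge G) Z) (trans (sym (lookup-V-∷ G false Z w)) ([]=⇒lookup w∈))))

x∈p─q⇒x∉q : ∀ {k} (p q : Subset k) {x} → x ∈ p ─ q → x ∉ q
x∈p─q⇒x∉q (true ∷ p) (false ∷ q) here       ()
x∈p─q⇒x∉q (_    ∷ p) (_     ∷ q) (there x∈) (there x∈q) = x∈p─q⇒x∉q p q x∈ x∈q

∩-monoʳ-Nonempty : ∀ {k} {p q r : Subset k} → q ⊆ r → Nonempty (p ∩ q) → Nonempty (p ∩ r)
∩-monoʳ-Nonempty {p = p} {q} q⊆r (x , x∈p∩q) =
  x , x∈p∩q⁺ (map₂ q⊆r (x∈p∩q⁻ p q x∈p∩q))

p∩r≡q∩r : ∀ {k} {p q r : Subset k} →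
  (∀ {x} → x ∈ r → x ∈ p → x ∈ q) → (∀ {x} → x ∈ r → x ∈ q → x ∈ p) → p ∩ r ≡ q ∩ r
p∩r≡q∩r {p = p} {q} {r} p⇒q q⇒p = ⊆-antisym (restrict p⇒q) (restrict q⇒p)
  where
  restrict : ∀ {s t} → (∀ {x} → x ∈ r → x ∈ s → x ∈ t) → s ∩ r ⊆ t ∩ r
  restrict {s} s⇒t x∈ = let (x∈s , x∈r) = x∈p∩q⁻ s r x∈ in x∈p∩q⁺ (s⇒t x∈r x∈s , x∈r)

module _ {n m : ℕ} (G : Graph n m) where
  open Graph G

  ∈S⁺ : ∀ {w f} → incident G w f ≡ true → f ∈ S G w
  ∈S⁺ {w} {f} inc = lookup⇒[]= f (S G w) (trans (lookup∘tabulate _ f) inc)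

  ∈S⁻ : ∀ {w f} → f ∈ S G w → incident G w f ≡ true
  ∈S⁻ {w} {f} f∈ = trans (sym (lookup∘tabulate _ f)) ([]=⇒lookup f∈)

  V-mono : ∀ {p q} → p ⊆ q → V G p ⊆ V G q
  V-mono p⊆q w∈ = let (f , f∈p , inc) = ∈V⁻ G w∈ in ∈V⁺ G (p⊆q f∈p) inc

  V-∪ : ∀ p q → V G (p ∪ q) ≡ V G p ∪ V G q
  V-∪ p q = ⊆-antisym to from
    where
    to : V G (p ∪ q) ⊆ V G p ∪ V G q
    to w∈ with ∈V⁻ G w∈
    ... | f , f∈p∪q , inc =
      x∈p∪q⁺ (Sum.map (λ f∈p → ∈V⁺ G f∈p inc) (λ f∈q → ∈V⁺ G f∈q inc) (x∈p∪q⁻ p q f∈p∪q))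
    from : V G p ∪ V G q ⊆ V G (p ∪ q)
    from w∈ with x∈p∪q⁻ (V G p) (V G q) w∈
    ... | inj₁ w∈p = V-mono (p⊆p∪q {p = p} q) w∈p
    ... | inj₂ w∈q = V-mono (q⊆p∪q p q) w∈q

  ∈V⁅e⁆⇒endpoint : ∀ {w e} → w ∈ V G ⁅ e ⁆ → w ≡ proj₁ (ends e) ⊎ w ≡ proj₂ (ends e)
  ∈V⁅e⁆⇒endpoint {w} {e} w∈ with ∈V⁻ G w∈
  ... | f , f∈e , inc = incident⇒endpoint (subst (λ f → incident G w f ≡ true) (x∈⁅y⁆⇒x≡y e f∈e) inc)
    where
    incident⇒endpoint : incident G w e ≡ true → w ≡ proj₁ (ends e) ⊎ w ≡ proj₂ (ends e)
    incident⇒endpoint inc with w ≟ proj₁ (ends e) | w ≟ proj₂ (ends e)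
    ... | yes w≡u | _       = inj₁ w≡u
    ... | no _    | yes w≡v = inj₂ w≡v
    incident⇒endpoint () | no _ | no _

  ∈V-avoiding⁺ : ∀ {Z w e} → Nonempty ((S G w - e) ∩ Z) → w ∈ V G Z
  ∈V-avoiding⁺ {Z} {w} {e} (f , f∈) = let (f∈S-e , f∈Z) = x∈p∩q⁻ (S G w - e) Z f∈ in
    ∈V⁺ G f∈Z (∈S⁻ {w} (p─q⊆p (S G w) ⁅ e ⁆ f∈S-e))

  ∈V-avoiding⁻ : ∀ {Z w e} → e ∉ Z → w ∈ V G Z → Nonempty ((S G w - e) ∩ Z)
  ∈V-avoiding⁻ {Z} {w} {e} e∉Z w∈ with ∈V⁻ G w∈
  ... | f , f∈Z , inc = f , x∈p∩q⁺ (x∈p∧x≢y⇒x∈p-y (∈S⁺ {w} inc) f≢e , f∈Z)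
    where
    f≢e : f ≢ e
    f≢e refl = e∉Z f∈Z

  ∈V∁-avoiding⁺ : ∀ {Z w e} → Nonempty ((S G w - e) ∩ ∁ Z) → w ∈ V G (∁ (Z ∪ ⁅ e ⁆))
  ∈V∁-avoiding⁺ {Z} {w} {e} (f , f∈) with x∈p∩q⁻ (S G w - e) (∁ Z) f∈
  ... | f∈S-e , f∈∁Z = ∈V⁺ G (x∉p⇒x∈∁p f∉Z∪e) (∈S⁻ {w} (p─q⊆p (S G w) ⁅ e ⁆ f∈S-e))
    where
    f∉Z∪e : f ∉ Z ∪ ⁅ e ⁆
    f∉Z∪e f∈Z∪e with x∈p∪q⁻ Z ⁅ e ⁆ f∈Z∪e
    ... | inj₁ f∈Z = x∈∁p⇒x∉p f∈∁Z f∈Z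
    ... | inj₂ f∈e = x∈p─q⇒x∉q (S G w) ⁅ e ⁆ f∈S-e f∈e

  ∈V∁-avoiding⁻ : ∀ {Z w e} → w ∈ V G (∁ (Z ∪ ⁅ e ⁆)) → Nonempty ((S G w - e) ∩ ∁ Z)
  ∈V∁-avoiding⁻ {Z} {w} {e} w∈ with ∈V⁻ G w∈
  ... | f , f∈∁Z∪e , inc = f , x∈p∩q⁺ (x∈p∧x≢y⇒x∈p-y (∈S⁺ {w} inc) f≢e , x∉p⇒x∈∁p f∉Z)
    where
    f∉Z∪e : f ∉ Z ∪ ⁅ e ⁆
    f∉Z∪e = x∈∁p⇒x∉p f∈∁Z∪e
    f≢e : f ≢ e
    f≢e refl = f∉Z∪e (x∈p∪q⁺ (inj₂ (x∈⁅x⁆ e)))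
    f∉Z : f ∉ Z
    f∉Z f∈Z = f∉Z∪e (x∈p∪q⁺ (inj₁ f∈Z))

  record Representative (T X A : Subset m) : Set where
    field
      controlled : Controlled G T A
      ⊆X         : A ⊆ X
      meets      : Nonempty (T ∩ X) → Nonempty (T ∩ A)
      misses     : Nonempty (T ∩ ∁ A) → Nonempty (T ∩ ∁ X)

  representative : ∀ T X → ∃ (Representative T X)
  representative T X with nonempty? (T ∩ ∁ X) | nonempty? (T ∩ X)
  ... | no T∩∁X-empty | _ = T , record
    { controlled = ⊆-refl , inj₁ refl
    ; ⊆X         = λ x∈T → x∉∁p⇒x∈p λ x∈∁X → T∩∁X-empty (_ , x∈p∩q⁺ (x∈T , x∈∁X))
    ; meets      = λ (x , x∈) → x , x∈p∩q⁺ (proj₁ (x∈p∩q⁻ T X x∈) , proj₁ (x∈p∩q⁻ T X x∈))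
    ; misses     = λ (x , x∈) →
        let (x∈T , x∈∁T) = x∈p∩q⁻ T (∁ T) x∈ in contradiction x∈T (x∈∁p⇒x∉p x∈∁T)
    }
  ... | yes T∩∁X-nonempty | yes (g , g∈T∩X) = ⁅ g ⁆ , record
    { controlled = (λ x∈g → subst (_∈ T) (sym (x∈⁅y⁆⇒x≡y g x∈g)) g∈T) , inj₂ (inj₂ (∣⁅x⁆∣≡1 g))
    ; ⊆X         = λ x∈g → subst (_∈ X) (sym (x∈⁅y⁆⇒x≡y g x∈g)) g∈X
    ; meets      = λ _ → g , x∈p∩q⁺ (g∈T , x∈⁅x⁆ g)
    ; misses     = λ _ → T∩∁X-nonempty
    }
    where
    g∈T = proj₁ (x∈p∩q⁻ T X g∈T∩X)
    g∈X = proj₂ (x∈p∩q⁻ T X g∈T∩X)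
  ... | yes T∩∁X-nonempty | no T∩X-empty = ⊥ , record
    { controlled = ⊥⊆ , inj₂ (inj₁ refl)
    ; ⊆X         = ⊥⊆
    ; meets      = λ meet → contradiction meet T∩X-empty
    ; misses     = λ _ → T∩∁X-nonempty
    }

  representative-transfers-V : ∀ {w e X Y A} → Representative (S G w - e) X A → A ⊆ Y → e ∉ X →
    (w ∈ V G X → w ∈ V G Y) × (w ∈ V G (∁ (Y ∪ ⁅ e ⁆)) → w ∈ V G (∁ (X ∪ ⁅ e ⁆)))
  representative-transfers-V rep A⊆Y e∉X =
    (λ w∈VX → ∈V-avoiding⁺ (∩-monoʳ-Nonempty A⊆Y (meets (∈V-avoiding⁻ e∉X w∈VX)))) ,
    (λ w∈V∁ → ∈V∁-avoiding⁺ (misses (∩-monoʳ-Nonempty (p⊆q⇒∁p⊇∁q A⊆Y) (∈V∁-avoiding⁻ w∈V∁))))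
    where open Representative rep

  record ControlledCore (e : Fin m) (X Y : Subset m) : Set where
    field
      ⊆X           : Y ⊆ X
      controlled   : eControlled G e Y
      controlled∪e : eControlled G e (Y ∪ ⁅ e ⁆)
      V∩ends       : V G Y ∩ V G ⁅ e ⁆ ≡ V G X ∩ V G ⁅ e ⁆
      V∁∩ends      : V G (∁ (Y ∪ ⁅ e ⁆)) ∩ V G ⁅ e ⁆ ≡ V G (∁ (X ∪ ⁅ e ⁆)) ∩ V G ⁅ e ⁆

  controlledCore : ∀ {e X} → e ∉ X → ∃ (ControlledCore e X)
  controlledCore {e} {X} e∉X = Aᵤ ∪ Aᵥ , record
    { ⊆X           = Y⊆X
    ; controlled   = Aᵤ , Aᵥ , ⊥ , controlledᵤ , controlledᵥ , (⊥⊆ , inj₂ (inj₁ refl)) ,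
                     sym (∪-identityʳ (Aᵤ ∪ Aᵥ))
    ; controlled∪e = Aᵤ , Aᵥ , ⁅ e ⁆ , controlledᵤ , controlledᵥ , (⊆-refl , inj₁ refl) , refl
    ; V∩ends       = p∩r≡q∩r (λ _ → V-mono Y⊆X) (λ w∈N → proj₁ (agreeAt w∈N))
    ; V∁∩ends      = p∩r≡q∩r (λ w∈N → proj₂ (agreeAt w∈N)) (λ _ → V-mono (p⊆q⇒∁p⊇∁q Y∪e⊆X∪e))
    }
    where
    Aᵤ = proj₁ (representative (S G (proj₁ (ends e)) - e) X)
    Aᵥ = proj₁ (representative (S G (proj₂ (ends e)) - e) X)
    repᵤ = proj₂ (representative (S G (proj₁ (ends e)) - e) X)
    repᵥ = proj₂ (representative (S G (proj₂ (ends e)) - e) X)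
    open Representative repᵤ renaming (controlled to controlledᵤ; ⊆X to Aᵤ⊆X) using ()
    open Representative repᵥ renaming (controlled to controlledᵥ; ⊆X to Aᵥ⊆X) using ()
    Y = Aᵤ ∪ Aᵥ

    Y⊆X : Y ⊆ X
    Y⊆X x∈Y with x∈p∪q⁻ Aᵤ Aᵥ x∈Y
    ... | inj₁ x∈Aᵤ = Aᵤ⊆X x∈Aᵤ
    ... | inj₂ x∈Aᵥ = Aᵥ⊆X x∈Aᵥ

    Y∪e⊆X∪e : Y ∪ ⁅ e ⁆ ⊆ X ∪ ⁅ e ⁆
    Y∪e⊆X∪e x∈ = x∈p∪q⁺ (Sum.map₁ Y⊆X (x∈p∪q⁻ Y ⁅ e ⁆ x∈))

    agreeAt : ∀ {w} → w ∈ V G ⁅ e ⁆ →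
      (w ∈ V G X → w ∈ V G Y) × (w ∈ V G (∁ (Y ∪ ⁅ e ⁆)) → w ∈ V G (∁ (X ∪ ⁅ e ⁆)))
    agreeAt {w} w∈N with ∈V⁅e⁆⇒endpoint {w} {e} w∈N
    ... | inj₁ refl = representative-transfers-V repᵤ (p⊆p∪q Aᵥ) e∉X
    ... | inj₂ refl = representative-transfers-V repᵥ (q⊆p∪q Aᵤ Aᵥ) e∉X

  module _ where
    open import Data.Nat using (_+_; _∸_; _≤_)
    open import Data.Nat.Properties using (+-assoc; +-∸-assoc; +-∸-comm; +-commutativeSemigroup; module ≤-Reasoning)
    open import Algebra.Properties.CommutativeSemigroup +-commutativeSemigroup using (x∙yz≈yx∙z; xy∙z≈x∙zy)

    ∣V⊤∣≤∣V∣+∣V∁∣ : ∀ Z → ∣ V G ⊤ ∣ ≤ ∣ V G Z ∣ + ∣ V G (∁ Z) ∣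
    ∣V⊤∣≤∣V∣+∣V∁∣ Z = begin
      ∣ V G ⊤ ∣                 ≡⟨ cong (∣_∣ ∘ V G) (p∪∁p≡⊤ Z) ⟨
      ∣ V G (Z ∪ ∁ Z) ∣         ≡⟨ cong ∣_∣ (V-∪ Z (∁ Z)) ⟩
      ∣ V G Z ∪ V G (∁ Z) ∣     ≤⟨ ∣p∪q∣≤∣p∣+∣q∣ (V G Z) (V G (∁ Z)) ⟩
      ∣ V G Z ∣ + ∣ V G (∁ Z) ∣ ∎
      where open ≤-Reasoning

    ∣V∣+∣V∁∣-∪-⁅⁆ : ∀ {Z e} → e ∉ Z →
      ∣ V G Z ∩ V G ⁅ e ⁆ ∣ + (∣ V G (Z ∪ ⁅ e ⁆) ∣ + ∣ V G (∁ (Z ∪ ⁅ e ⁆)) ∣)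
        ≡ (∣ V G Z ∣ + ∣ V G (∁ Z) ∣) + ∣ V G (∁ (Z ∪ ⁅ e ⁆)) ∩ V G ⁅ e ⁆ ∣
    ∣V∣+∣V∁∣-∪-⁅⁆ {Z} {e} e∉Z = begin
      ∣ P ∩ N ∣ + (∣ V G (Z ∪ ⁅ e ⁆) ∣ + ∣ C ∣) ≡⟨ cong (λ q → ∣ P ∩ N ∣ + (∣ q ∣ + ∣ C ∣)) (V-∪ Z ⁅ e ⁆) ⟩
      ∣ P ∩ N ∣ + (∣ P ∪ N ∣ + ∣ C ∣)           ≡⟨ x∙yz≈yx∙z (∣ P ∩ N ∣) (∣ P ∪ N ∣) (∣ C ∣) ⟩
      (∣ P ∪ N ∣ + ∣ P ∩ N ∣) + ∣ C ∣           ≡⟨ cong (_+ ∣ C ∣) (∣p∪q∣+∣p∩q∣≡∣p∣+∣q∣ P N) ⟩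
      (∣ P ∣ + ∣ N ∣) + ∣ C ∣                   ≡⟨ xy∙z≈x∙zy (∣ P ∣) (∣ N ∣) (∣ C ∣) ⟩
      ∣ P ∣ + (∣ C ∣ + ∣ N ∣)                   ≡⟨ cong (∣ P ∣ +_) (∣p∪q∣+∣p∩q∣≡∣p∣+∣q∣ C N) ⟨
      ∣ P ∣ + (∣ C ∪ N ∣ + ∣ C ∩ N ∣)           ≡⟨ +-assoc (∣ P ∣) (∣ C ∪ N ∣) (∣ C ∩ N ∣) ⟨
      (∣ P ∣ + ∣ C ∪ N ∣) + ∣ C ∩ N ∣           ≡⟨ cong (λ q → (∣ P ∣ + ∣ q ∣) + ∣ C ∩ N ∣) V∁Z≡C∪N ⟨
      (∣ P ∣ + ∣ V G (∁ Z) ∣) + ∣ C ∩ N ∣       ∎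
      where
      open ≡-Reasoning
      P = V G Z
      N = V G ⁅ e ⁆
      C = V G (∁ (Z ∪ ⁅ e ⁆))
      V∁Z≡C∪N : V G (∁ Z) ≡ C ∪ N
      V∁Z≡C∪N = trans (cong (V G) (∁p≡∁[p∪⁅x⁆]∪⁅x⁆ e∉Z)) (V-∪ (∁ (Z ∪ ⁅ e ⁆)) ⁅ e ⁆)

    γ-∪-⁅⁆ : ∀ {Z e} → e ∉ Z →
      ∣ V G Z ∩ V G ⁅ e ⁆ ∣ + γ G (Z ∪ ⁅ e ⁆) ≡ γ G Z + ∣ V G (∁ (Z ∪ ⁅ e ⁆)) ∩ V G ⁅ e ⁆ ∣
    γ-∪-⁅⁆ {Z} {e} e∉Z = begin
      a + (∣ V G (Z ∪ ⁅ e ⁆) ∣ + ∣ V G (∁ (Z ∪ ⁅ e ⁆)) ∣ ∸ c) ≡⟨ +-∸-assoc a (∣V⊤∣≤∣V∣+∣V∁∣ (Z ∪ ⁅ e ⁆)) ⟨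
      a + (∣ V G (Z ∪ ⁅ e ⁆) ∣ + ∣ V G (∁ (Z ∪ ⁅ e ⁆)) ∣) ∸ c ≡⟨ cong (_∸ c) (∣V∣+∣V∁∣-∪-⁅⁆ e∉Z) ⟩
      (∣ V G Z ∣ + ∣ V G (∁ Z) ∣) + b ∸ c                     ≡⟨ +-∸-comm b (∣V⊤∣≤∣V∣+∣V∁∣ Z) ⟩
      (∣ V G Z ∣ + ∣ V G (∁ Z) ∣ ∸ c) + b                     ∎
      where
      open ≡-Reasoning
      a = ∣ V G Z ∩ V G ⁅ e ⁆ ∣
      b = ∣ V G (∁ (Z ∪ ⁅ e ⁆)) ∩ V G ⁅ e ⁆ ∣
      c = ∣ V G ⊤ ∣

module _ {ℓ} (R : OrderedAbelianGroup ℓ) where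
  open OrderedAbelianGroup R

  private
    -‿inverseʳ : ∀ x → x + (- x) ≡ 0#
    -‿inverseʳ x = trans (+-comm x (- x)) (-‿inverseˡ x)

    cancelˡ : ∀ x y z → (x + y) + ((- x) + z) ≡ y + z
    cancelˡ x y z = begin
      (x + y) + ((- x) + z) ≡⟨ cong (_+ ((- x) + z)) (+-comm x y) ⟩
      (y + x) + ((- x) + z) ≡⟨ +-assoc y x _ ⟩
      y + (x + ((- x) + z)) ≡⟨ cong (y +_) (+-assoc x (- x) z) ⟨
      y + ((x + (- x)) + z) ≡⟨ cong (λ t → y + (t + z)) (-‿inverseʳ x) ⟩
      y + (0# + z)          ≡⟨ cong (y +_) (+-identityˡ z) ⟩
      y + z                 ∎
      where open ≡-Reasoning

  +≤+⇒−≤− : ∀ {x y z w} → x + y ≤ z + w → y − z ≤ w − x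
  +≤+⇒−≤− {x} {y} {z} {w} le = subst₂ _≤_ (cancelˡ x y (- z)) rhs (+-monoˡ-≤ ((- x) + (- z)) le)
    where
    rhs : (z + w) + ((- x) + (- z)) ≡ w − x
    rhs = trans (cong ((z + w) +_) (+-comm (- x) (- z))) (cancelˡ z w (- x))

  +≡+⇒−≡− : ∀ {x y z w} → x + y ≡ z + w → y − z ≡ w − x
  +≡+⇒−≡− {x} {y} {z} {w} eq =
    ≤-antisym (+≤+⇒−≤− (subst (x + y ≤_) eq ≤-refl)) (+≤+⇒−≤− (subst (z + w ≤_) (sym eq) ≤-refl))

  ι-+ : ∀ m n → ι (m ℕ.+ n) ≡ ι m + ι n
  ι-+ ℕ.zero    n = sym (+-identityˡ (ι n))
  ι-+ (ℕ.suc m) n = trans (cong (one +_) (ι-+ m n)) (sym (+-assoc one (ι m) (ι n)))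

  submodular-increment : ∀ {m} (λf : Subset m → Carrier) →
    (∀ X Y → λf (X ∩ Y) + λf (X ∪ Y) ≤ λf X + λf Y) →
    ∀ {X Y e} → Y ⊆ X → e ∉ X → λf (X ∪ ⁅ e ⁆) − λf X ≤ λf (Y ∪ ⁅ e ⁆) − λf Y
  submodular-increment λf submod {X} {Y} {e} Y⊆X e∉X = +≤+⇒−≤−
    (subst₂ (λ A B → λf A + λf B ≤ λf X + λf (Y ∪ ⁅ e ⁆))
      (p∩[q∪⁅x⁆]≡q Y⊆X e∉X) (p∪[q∪⁅x⁆]≡p∪⁅x⁆ Y⊆X) (submod X (Y ∪ ⁅ e ⁆)))

  γ-increment : ∀ {n m} (G : Graph n m) {Z e} → e ∉ Z →
    ι (γ G (Z ∪ ⁅ e ⁆)) − ι (γ G Z) ≡ ι ∣ V G (∁ (Z ∪ ⁅ e ⁆)) ∩ V G ⁅ e ⁆ ∣ − ι ∣ V G Z ∩ V G ⁅ e ⁆ ∣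
  γ-increment G {Z} {e} e∉Z =
    +≡+⇒−≡− (trans (sym (ι-+ a (γ G (Z ∪ ⁅ e ⁆)))) (trans (cong ι (γ-∪-⁅⁆ G e∉Z)) (ι-+ (γ G Z) b)))
    where
    a = ∣ V G Z ∩ V G ⁅ e ⁆ ∣
    b = ∣ V G (∁ (Z ∪ ⁅ e ⁆)) ∩ V G ⁅ e ⁆ ∣

lemma2 : ∀ {a} (R : OrderedAbelianGroup a) → let open OrderedAbelianGroup R in
    {n m : ℕ} (G : Graph n m) → NoIsolatedVertices G →
    (λf : Subset m → Carrier) → IsConnectivityFunction R λf →
    (∀ (e : Fin m) (Y : Subset m) → eControlled G e Y → λf Y ≡ ι (γ G Y)) →
    ∀ (X : Subset m) (e : Fin m) → e ∉ X →
    λf (X ∪ ⁅ e ⁆) − λf X ≤ ι (γ G (X ∪ ⁅ e ⁆)) − ι (γ G X)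
lemma2 R G _ λf isConnectivity λ≡γ X e e∉X =
  subst (λf (X ∪ ⁅ e ⁆) − λf X ≤_) increments (submodular-increment R λf submod ⊆X e∉X)
  where
  open OrderedAbelianGroup R
  open IsConnectivityFunction isConnectivity using (submod)
  Y = proj₁ (controlledCore G e∉X)
  open ControlledCore (proj₂ (controlledCore G e∉X))
  N = V G ⁅ e ⁆

  increments : λf (Y ∪ ⁅ e ⁆) − λf Y ≡ ι (γ G (X ∪ ⁅ e ⁆)) − ι (γ G X)
  increments = begin
    λf (Y ∪ ⁅ e ⁆) − λf Y                            ≡⟨ cong₂ _−_ (λ≡γ e _ controlled∪e) (λ≡γ e Y controlled) ⟩
    ι (γ G (Y ∪ ⁅ e ⁆)) − ι (γ G Y)                  ≡⟨ γ-increment R G (e∉X ∘ ⊆X) ⟩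
    ι ∣ V G (∁ (Y ∪ ⁅ e ⁆)) ∩ N ∣ − ι ∣ V G Y ∩ N ∣ ≡⟨ cong₂ (λ p q → ι ∣ p ∣ − ι ∣ q ∣) V∁∩ends V∩ends ⟩
    ι ∣ V G (∁ (X ∪ ⁅ e ⁆)) ∩ N ∣ − ι ∣ V G X ∩ N ∣ ≡⟨ γ-increment R G e∉X ⟨
    ι (γ G (X ∪ ⁅ e ⁆)) − ι (γ G X)                  ∎
    where open ≡-Reasoning
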